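{- Let $\Sigma=\{0,1\}$ and let $S=\{s_1,s_2,s_3\}$ be a set of three binary strings in $\Sigma^n$. Let $D^*=\min_{u\in\Sigma^n}\max_{1\le i\le 3} d(u,s_i)$ be the optimal closest-string distance, and let $t$ be the string output by Algorithm A (described in the context) on $S$. Then the error of Algorithm A is at most one, i.e. $\max_{1\le i\le 3} d(t,s_i)-D^*\le 1$.
   Context: For equal-length strings $s,t$, $d(s,t)$ is the Hamming distance (number of positions $i$ with $s[i]\neq t[i]$). The closest string problem (CSP): given $S=\{s_1,\dots,s_m\}\subseteq\Sigma^n$, find $t\in\Sigma^n$ minimizing $d$ subject to $d(t,s_i)\le d$ for all $i$. It is formulated as the integer program: minimize $d$ subject to $\sum_{a\in\Sigma}x_{a,j}=1$ for $j=1,\dots,n$, and $n-\sum_{j=1}^n x_{s_i[j],j}\le d$ for $i=1,\dots,m$, with $x_{a,j}\in\{0,1\}$ and $d$ a nonnegative integer ($x_{a,j}=1$ means $t[j]=a$). Its LP relaxation replaces $x_{a,j}\in\{0,1\}$ by $0\le x_{a,j}\le 1$ and lets $d$ be real. Algorithm A: start with $V_1=V_0=\emptyset$. For $i=1,\dots,n$: fix all variables in $V_1$ to $1$ and all variables in $V_0$ to $0$; solve the LP relaxation in the remaining (unfixed) variables; pick a variable $x_{b,k}$ not in $V_1$ having the largest value in this LP optimal solution; add $x_{b,k}$ to $V_1$ and add all $x_{a,k}$ with $a\neq b$ to $V_0$. Finally output the string $t$ with $t[k]=a$ for every $x_{a,k}\in V_1$. The error of the algorithm is the difference between the distance of the solution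 it obtains and the optimal distance. -}

module Defs where

open import Data.Nat as ℕ using (ℕ; zero; suc)
open import Data.Fin using (Fin; zero; suc; _≟_)
open import Data.Bool using (Bool; true; false; not; if_then_else_)
open import Data.Maybe using (Maybe; just; nothing)
open import Data.List using (List; []; _∷_)
open import Data.List.Relation.Unary.All using (All)
open import Data.Integer using (+_)
open import Data.Rational using (ℚ; 0ℚ; 1ℚ; _+_; _-_; _≤_; _/_)
open import Data.Product using (_×_; ∃)
open import Relation.Nullary using (¬_; does)
open import Relation.Binary.PropositionalEquality using (_≡_; _≢_)

-- Binary strings of length n over Σ = {0,1} (false = 0, true = 1).
Str : ℕ → Set
Str n = Fin n → Bool

ham : ∀ {n} → Str n → Str n → ℕ
ham {zero} s t = 0
ham {suc n} s t =
  (if does (Data.Bool._≟_ (s zero) (t zero)) then 0 else 1)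
  ℕ.+ ham {n} (λ j → s (suc j)) (λ j → t (suc j))

maxDist : ∀ {n} → List (Str n) → Str n → ℕ
maxDist [] t = 0
maxDist (s ∷ ss) t = ham t s ℕ.⊔ maxDist ss t

sumℚ : ∀ {n} → (Fin n → ℚ) → ℚ
sumℚ {zero} f = 0ℚ
sumℚ {suc n} f = f zero + sumℚ {n} (λ j → f (suc j))

ℕtoℚ : ℕ → ℚ
ℕtoℚ k = + k / 1

-- LP variables: x a j (a ∈ Σ, j ∈ positions) and the real d.
LPVars : ℕ → Set
LPVars n = Fin n → Bool → ℚ

-- Fixed variables (V₁,V₀) for the binary alphabet: F j ≡ just b means
-- x_{b,j} ∈ V₁ and x_{not b,j} ∈ V₀; F j ≡ nothing means column j is unfixed.
Fixing : ℕ → Set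
Fixing n = Fin n → Maybe Bool

Feasible : ∀ {n} → List (Str n) → Fixing n → LPVars n → ℚ → Set
Feasible {n} S F x d =
  (∀ a j → 0ℚ ≤ x j a) × (∀ a j → x j a ≤ 1ℚ) × (0ℚ ≤ d)
  × (∀ j → x j false + x j true ≡ 1ℚ)
  × All (λ s → ℕtoℚ n - sumℚ (λ j → x j (s j)) ≤ d) S
  × (∀ j b → F j ≡ just b → (x j b ≡ 1ℚ) × (x j (not b) ≡ 0ℚ))

Optimal : ∀ {n} → List (Str n) → Fixing n → LPVars n → ℚ → Set
Optimal S F x d = Feasible S F x d × (∀ y e → Feasible S F y e → d ≤ e)

update : ∀ {n} → Fixing n → Fin n → Bool → Fixing n
update F k b j = if does (j ≟ k) then just b else F j

-- Reach S i F : after i iterations of Algorithm A (with any optimal LP solution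
-- and any tie-breaking), the fixings are F.
data Reach {n} (S : List (Str n)) : ℕ → Fixing n → Set where
  start : Reach S 0 (λ _ → nothing)
  step  : ∀ {i F} → Reach S i F →
          (x : LPVars n) (d : ℚ) → Optimal S F x d →
          (b : Bool) (k : Fin n) → F k ≢ just b →
          (∀ a j → F j ≢ just a → x j a ≤ x k b) →
          Reach S (suc i) (update F k b)

-- Output of Algorithm A after n iterations: t[k] = a for x_{a,k} ∈ V₁.
Output : ∀ {n} → List (Str n) → Str n → Set
Output {n} S t = ∃ λ F → Reach S n F × (∀ k → F k ≡ just (t k))

-- Let D be the distance of an arbitrary string u; its indicator shows that
-- the first LP optimum is at most D.  If an iteration has LP optimum d and
-- rounds column k to the letter b, moving the mass δ = x_{¬b,k} ≤ ½ onto b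
-- yields a feasible point of value d + δ for the next LP.  When δ > 0 every
-- letter of every unfixed column has mass ≥ δ, and optimality forces a
-- "split pair": two tight strings differing on all unfixed columns.  The sum
-- of their fractional distances is then the same (2d) at every admissible
-- point of all later LPs, so once recorded such a pair caps the optimum
-- whenever it is tight again.  At most two pairs can be split while a column
-- is unfixed; hence the optimum climbs from D to at most D + ½ and D + 1
-- (the invariant Stage), and the final LP value is the output's distance.

module Submission where

open import Defs

module AlgorithmA where

  open import Data.Bool using (Bool; true; false; not; if_then_else_)
  open import Data.Bool.Properties using (not-¬; ¬-not; not-involutive)
  import Data.Bool as Bool
  open import Data.Empty using (⊥; ⊥-elim)
  open import Data.Fin using (Fin; zero; suc; _≟_)
  open import Data.Fin.Properties using (suc-injective; any?)
  open import Data.List using (List; []; _∷_)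
  open import Data.List.Relation.Unary.All as All using (All; []; _∷_)
  open import Data.Maybe using (Maybe; just; nothing)
  open import Data.Maybe.Properties using (≡-dec; just-injective)
  open import Data.Nat as ℕ using (ℕ; zero; suc)
  import Data.Nat.Properties as ℕ
  import Data.Integer as ℤ
  import Data.Integer.Properties as ℤ
  open import Data.Product using (Σ; ∃; ∃-syntax; _×_; _,_; proj₁; proj₂; uncurry)
  open import Data.Rational
    using (ℚ; 0ℚ; 1ℚ; ½; _+_; _-_; -_; _*_; _≤_; _<_; _⊓_; toℚᵘ; *<*)
  open import Data.Rational.Properties hiding (_≟_)
  import Data.Rational.Unnormalised as U
  import Data.Rational.Unnormalised.Properties as U
  open import Data.Rational.Solver using (module +-*-Solver)
  open import Function using (_∘_)
  open import Data.Sum using (_⊎_; inj₁; inj₂)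
  open import Relation.Binary.PropositionalEquality
  open import Relation.Nullary using (¬_; Dec; yes; no; does)
  open import Relation.Nullary.Decidable using (_×-dec_)
  open +-*-Solver

  ℕtoℚ-suc : ∀ k → ℕtoℚ (suc k) ≡ 1ℚ + ℕtoℚ k
  ℕtoℚ-suc k = toℚᵘ-injective (begin
      toℚᵘ (ℕtoℚ (suc k))               ≈⟨ toℚᵘ-fromℚᵘ (U.mkℚᵘ (ℤ.+ suc k) 0) ⟩
      U.mkℚᵘ (ℤ.+ suc k) 0              ≈⟨ U.*≡* numerators ⟩
      U.mkℚᵘ (ℤ.+ 1) 0 U.+ U.mkℚᵘ (ℤ.+ k) 0
        ≈⟨ U.+-congʳ (toℚᵘ 1ℚ) (U.≃-sym (toℚᵘ-fromℚᵘ (U.mkℚᵘ (ℤ.+ k) 0))) ⟩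
      toℚᵘ 1ℚ U.+ toℚᵘ (ℕtoℚ k)          ≈⟨ U.≃-sym (toℚᵘ-homo-+ 1ℚ (ℕtoℚ k)) ⟩
      toℚᵘ (1ℚ + ℕtoℚ k)                ∎)
    where
    open U.≃-Reasoning
    numerators : ℤ.+ suc k ℤ.* ℤ.+ 1 ≡ (ℤ.+ 1 ℤ.* ℤ.+ 1 ℤ.+ ℤ.+ k ℤ.* ℤ.+ 1) ℤ.* ℤ.+ 1
    numerators = trans (ℤ.*-identityʳ _)
      (sym (trans (ℤ.*-identityʳ _) (cong (λ z → ℤ.+ 1 ℤ.+ z) (ℤ.*-identityʳ (ℤ.+ k)))))

  ℕtoℚ-+ : ∀ a b → ℕtoℚ (a ℕ.+ b) ≡ ℕtoℚ a + ℕtoℚ b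
  ℕtoℚ-+ zero    b = sym (+-identityˡ (ℕtoℚ b))
  ℕtoℚ-+ (suc a) b = begin
    ℕtoℚ (suc (a ℕ.+ b))    ≡⟨ ℕtoℚ-suc (a ℕ.+ b) ⟩
    1ℚ + ℕtoℚ (a ℕ.+ b)     ≡⟨ cong (1ℚ +_) (ℕtoℚ-+ a b) ⟩
    1ℚ + (ℕtoℚ a + ℕtoℚ b)  ≡⟨ sym (+-assoc 1ℚ (ℕtoℚ a) (ℕtoℚ b)) ⟩
    1ℚ + ℕtoℚ a + ℕtoℚ b    ≡⟨ cong (_+ ℕtoℚ b) (sym (ℕtoℚ-suc a)) ⟩
    ℕtoℚ (suc a) + ℕtoℚ b   ∎
    where open ≡-Reasoning

  0≤1 : 0ℚ ≤ 1ℚ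
  0≤1 = ≤ᵇ⇒≤ _

  0<1 : 0ℚ < 1ℚ
  0<1 = *<* (ℤ.+<+ (ℕ.s≤s ℕ.z≤n))

  ½≤1 : ½ ≤ 1ℚ
  ½≤1 = ≤ᵇ⇒≤ _

  p≤p+q : ∀ p {q} → 0ℚ ≤ q → p ≤ p + q
  p≤p+q p {q} 0≤q = subst (_≤ p + q) (+-identityʳ p) (+-monoʳ-≤ p 0≤q)

  ℕtoℚ-nonneg : ∀ k → 0ℚ ≤ ℕtoℚ k
  ℕtoℚ-nonneg k = nonNegative⁻¹ (ℕtoℚ k) {{normalize-nonNeg k 1}}

  ℕtoℚ-mono : ∀ {a b} → a ℕ.≤ b → ℕtoℚ a ≤ ℕtoℚ b
  ℕtoℚ-mono {a} a≤b with ℕ.m≤n⇒∃[o]m+o≡n a≤b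
  ... | o , refl = subst (ℕtoℚ a ≤_) (sym (ℕtoℚ-+ a o)) (p≤p+q (ℕtoℚ a) (ℕtoℚ-nonneg o))

  ℕtoℚ-cancel-≤ : ∀ {a b} → ℕtoℚ a ≤ ℕtoℚ b → a ℕ.≤ b
  ℕtoℚ-cancel-≤ {a} {b} h with a ℕ.≤? b
  ... | yes a≤b = a≤b
  ... | no  a≰b = ⊥-elim (<-irrefl refl (<-≤-trans b<a h))
    where
    b<1+b : ℕtoℚ b < ℕtoℚ (suc b)
    b<1+b = subst₂ _<_ (+-identityʳ (ℕtoℚ b)) (trans (+-comm (ℕtoℚ b) 1ℚ) (sym (ℕtoℚ-suc b)))
                   (+-monoʳ-< (ℕtoℚ b) 0<1)
    b<a : ℕtoℚ b < ℕtoℚ a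
    b<a = <-≤-trans b<1+b (ℕtoℚ-mono (ℕ.≰⇒> a≰b))

  p-q≤p : ∀ p {q} → 0ℚ ≤ q → p - q ≤ p
  p-q≤p p {q} 0≤q = subst (p - q ≤_) (+-identityʳ p) (+-monoʳ-≤ p (neg-antimono-≤ 0≤q))

  p-q<p : ∀ p {q} → 0ℚ < q → p - q < p
  p-q<p p {q} 0<q = subst (p - q <_) (+-identityʳ p) (+-monoʳ-< p (neg-antimono-< 0<q))

  p≤q⇒0≤q-p : ∀ {p q} → p ≤ q → 0ℚ ≤ q - p
  p≤q⇒0≤q-p {p} {q} p≤q = subst (_≤ q - p) (+-inverseʳ p) (+-monoˡ-≤ (- p) p≤q)

  p<q⇒0<q-p : ∀ {p q} → p < q → 0ℚ < q - p
  p<q⇒0<q-p {p} {q} p<q = subst (_< q - p) (+-inverseʳ p) (+-monoˡ-< (- p) p<q)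

  half-pos : ∀ {q} → 0ℚ < q → 0ℚ < q * ½
  half-pos {q} 0<q = subst (_< q * ½) (*-zeroˡ ½) (*-monoˡ-<-pos ½ 0<q)

  halfway< : ∀ {c d} → c < d → c + (d - c) * ½ < d
  halfway< {c} {d} c<d =
    subst₂ _<_ (+-identityʳ _) halves (+-monoʳ-< (c + (d - c) * ½) (half-pos (p<q⇒0<q-p c<d)))
    where
    halves : c + (d - c) * ½ + (d - c) * ½ ≡ d
    halves = solve 2 (λ c d → c :+ (d :- c) :* con ½ :+ (d :- c) :* con ½ := d) refl c d

  halve-≤ : ∀ {p r} → p + p ≤ r + r → p ≤ r
  halve-≤ {p} {r} h with p ≤? r
  ... | yes p≤r = p≤r
  ... | no  p≰r = ⊥-elim (<-irrefl refl (≤-<-trans h (+-mono-< (≰⇒> p≰r) (≰⇒> p≰r))))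

  complement-≤ : ∀ {a b c e} → a + b ≡ 1ℚ → c + e ≡ 1ℚ → c ≤ a → b ≤ e
  complement-≤ {a} {b} {c} {e} a+b≡1 c+e≡1 c≤a = begin
    b            ≡⟨ solve 2 (λ a b → b := (a :+ b) :- a) refl a b ⟩
    (a + b) - a  ≡⟨ cong (_- a) a+b≡1 ⟩
    1ℚ - a       ≤⟨ +-monoʳ-≤ 1ℚ (neg-antimono-≤ c≤a) ⟩
    1ℚ - c       ≡⟨ cong (_- c) (sym c+e≡1) ⟩
    (c + e) - c  ≡⟨ solve 2 (λ c e → (c :+ e) :- c := e) refl c e ⟩
    e            ∎
    where open ≤-Reasoning

  half-step : ∀ D {d δ} → d ≤ D + ½ → δ ≤ ½ → d + δ ≤ D + 1ℚ
  half-step D d≤ δ≤ =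
    ≤-trans (+-mono-≤ d≤ δ≤) (≤-reflexive (solve 1 (λ D → D :+ con ½ :+ con ½ := D :+ con 1ℚ) refl D))

  sumℚ-cong : ∀ {n} {f g : Fin n → ℚ} → (∀ j → f j ≡ g j) → sumℚ f ≡ sumℚ g
  sumℚ-cong {zero}  f≡g = refl
  sumℚ-cong {suc n} f≡g = cong₂ _+_ (f≡g zero) (sumℚ-cong (λ j → f≡g (suc j)))

  sumℚ-mono : ∀ {n} {f g : Fin n → ℚ} → (∀ j → f j ≤ g j) → sumℚ f ≤ sumℚ g
  sumℚ-mono {zero}  f≤g = ≤-refl
  sumℚ-mono {suc n} f≤g = +-mono-≤ (f≤g zero) (sumℚ-mono (λ j → f≤g (suc j)))

  sumℚ-+ : ∀ {n} (f g : Fin n → ℚ) → sumℚ (λ j → f j + g j) ≡ sumℚ f + sumℚ g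
  sumℚ-+ {zero}  f g = refl
  sumℚ-+ {suc n} f g =
    trans (cong ((f zero + g zero) +_) (sumℚ-+ (λ j → f (suc j)) (λ j → g (suc j))))
          (solve 4 (λ a b c d → (a :+ b) :+ (c :+ d) := (a :+ c) :+ (b :+ d)) refl (f zero) (g zero) _ _)

  sumℚ-ones : ∀ {n} → sumℚ {n} (λ _ → 1ℚ) ≡ ℕtoℚ n
  sumℚ-ones {zero}  = refl
  sumℚ-ones {suc n} = trans (cong (1ℚ +_) (sumℚ-ones {n})) (sym (ℕtoℚ-suc n))

  sumℚ-point : ∀ {n} (k : Fin n) (f g : Fin n → ℚ) → (∀ j → j ≢ k → f j ≡ g j) →
    sumℚ f ≡ sumℚ g + (f k - g k)
  sumℚ-point zero f g agree =
    trans (cong (f zero +_) (sumℚ-cong (λ j → agree (suc j) (λ ()))))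
          (solve 3 (λ a b c → a :+ c := (b :+ c) :+ (a :- b)) refl (f zero) (g zero) _)
  sumℚ-point (suc k) f g agree =
    trans (cong₂ _+_ (agree zero (λ ()))
            (sumℚ-point k (λ j → f (suc j)) (λ j → g (suc j)) (λ j j≢k → agree (suc j) (j≢k ∘ suc-injective))))
          (solve 3 (λ a b c → a :+ (b :+ c) := (a :+ b) :+ c) refl (g zero) _ _)

  -- A point x assigns to each column j a distribution x j
  -- on {0,1}; its fractional distance from a string s is n - Σ_j x_{s[j],j},
  -- which is the Hamming distance when x is the indicator of a string.

  fdist : ∀ {n} → Str n → LPVars n → ℚ
  fdist {n} s x = ℕtoℚ n - sumℚ (λ j → x j (s j))

  record Admissible {n} (F : Fixing n) (x : LPVars n) : Set where
    field
      nonneg  : ∀ a j → 0ℚ ≤ x j a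
      atMost1 : ∀ a j → x j a ≤ 1ℚ
      column  : ∀ j → x j false + x j true ≡ 1ℚ
      fixed   : ∀ j b → F j ≡ just b → (x j b ≡ 1ℚ) × (x j (not b) ≡ 0ℚ)

    column′ : ∀ j a → x j a + x j (not a) ≡ 1ℚ
    column′ j false = column j
    column′ j true  = trans (+-comm (x j true) (x j false)) (column j)

    fdist-nonneg : ∀ s → 0ℚ ≤ fdist {n} s x
    fdist-nonneg s = p≤q⇒0≤q-p (subst (sumℚ (λ j → x j (s j)) ≤_) (sumℚ-ones {n})
                                (sumℚ-mono {n} (λ j → atMost1 (s j) j)))

  open Admissible

  module _ {n} {S : List (Str n)} {F : Fixing n} {x : LPVars n} {d : ℚ} where

    admissible : Feasible S F x d → Admissible F x
    admissible (nn , ≤1 , _ , col , _ , fx) = record { nonneg = nn ; atMost1 = ≤1 ; column = col ; fixed = fx }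

    within : Feasible S F x d → All (λ s → fdist s x ≤ d) S
    within (_ , _ , _ , _ , w , _) = w

    objective-nonneg : Feasible S F x d → 0ℚ ≤ d
    objective-nonneg (_ , _ , 0≤d , _ , _ , _) = 0≤d

    feasible : Admissible F x → 0ℚ ≤ d → All (λ s → fdist s x ≤ d) S → Feasible S F x d
    feasible A 0≤d w = nonneg A , atMost1 A , 0≤d , column A , w , fixed A

  fixed-agree : ∀ {n F x y} {j : Fin n} {b} → Admissible F x → Admissible F y →
    F j ≡ just b → ∀ a → x j a ≡ y j a
  fixed-agree {x = x} {y} {j} {b} Ax Ay Fj a with a Bool.≟ b
  ... | yes refl = trans (proj₁ (fixed Ax j b Fj)) (sym (proj₁ (fixed Ay j b Fj)))
  ... | no  a≢b  = subst (λ a → x j a ≡ y j a) (sym (¬-not a≢b))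
                     (trans (proj₂ (fixed Ax j b Fj)) (sym (proj₂ (fixed Ay j b Fj))))

  -- Shifting mass inside one column.  shift x j v ε moves ε of the mass of
  -- column j from the letter not v to the letter v; other columns are unchanged.

  towards : Bool → Bool → ℚ → ℚ → ℚ
  towards false false ε q = q + ε
  towards false true  ε q = q - ε
  towards true  true  ε q = q + ε
  towards true  false ε q = q - ε

  towards-same : ∀ v ε q → towards v v ε q ≡ q + ε
  towards-same false ε q = refl
  towards-same true  ε q = refl

  towards-not : ∀ v ε q → towards v (not v) ε q ≡ q - ε
  towards-not false ε q = refl
  towards-not true  ε q = refl

  shift : ∀ {n} → LPVars n → Fin n → Bool → ℚ → LPVars n
  shift x j v ε j′ a = if does (j′ ≟ j) then towards v a ε (x j′ a) else x j′ a

  shift-here : ∀ {n} (x : LPVars n) j v ε a → shift x j v ε j a ≡ towards v a ε (x j a)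
  shift-here x j v ε a with j ≟ j
  ... | yes _   = refl
  ... | no  j≢j = ⊥-elim (j≢j refl)

  shift-elsewhere : ∀ {n} (x : LPVars n) {j j′} v ε a → j′ ≢ j → shift x j v ε j′ a ≡ x j′ a
  shift-elsewhere x {j} {j′} v ε a j′≢j with j′ ≟ j
  ... | yes j′≡j = ⊥-elim (j′≢j j′≡j)
  ... | no  _    = refl

  bool-cases : ∀ a v → a ≡ v ⊎ a ≡ not v
  bool-cases false false = inj₁ refl
  bool-cases false true  = inj₂ refl
  bool-cases true  false = inj₂ refl
  bool-cases true  true  = inj₁ refl

  unfixed≢just : ∀ {m : Maybe Bool} {a} → m ≡ nothing → m ≢ just a
  unfixed≢just refl ()

  admissible-shift : ∀ {n F x} {j : Fin n} {v ε} → Admissible F x → F j ≡ nothing →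
    0ℚ ≤ ε → ε ≤ x j (not v) → Admissible F (shift x j v ε)
  admissible-shift {n} {F} {x} {j} {v} {ε} A Fj 0≤ε ε≤ = record
    { nonneg  = λ a j′ → onColumn {0ℚ ≤_} j′ (nonneg A a j′) (here-nonneg a)
    ; atMost1 = λ a j′ → onColumn {_≤ 1ℚ} j′ (atMost1 A a j′) (here-≤1 a)
    ; column  = λ j′ → onColumn2 {λ p q → p + q ≡ 1ℚ} j′ (column A j′) (here-sum v)
    ; fixed   = λ j′ b Fj′ → let j′≢j = λ { refl → unfixed≢just Fj Fj′ } in
        trans (shift-elsewhere x v ε b j′≢j) (proj₁ (fixed A j′ b Fj′)) ,
        trans (shift-elsewhere x v ε (not b) j′≢j) (proj₂ (fixed A j′ b Fj′))
    }
    where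
    y = shift x j v ε
    onColumn : ∀ {P : ℚ → Set} {a} j′ → P (x j′ a) → P (towards v a ε (x j a)) → P (y j′ a)
    onColumn j′ off on with j′ ≟ j
    ... | yes refl = on
    ... | no  _    = off
    onColumn2 : ∀ {R : ℚ → ℚ → Set} j′ → R (x j′ false) (x j′ true) →
      R (towards v false ε (x j false)) (towards v true ε (x j true)) → R (y j′ false) (y j′ true)
    onColumn2 j′ off on with j′ ≟ j
    ... | yes refl = on
    ... | no  _    = off
    here-nonneg : ∀ a → 0ℚ ≤ towards v a ε (x j a)
    here-nonneg a with bool-cases a v
    ... | inj₁ refl = subst (0ℚ ≤_) (sym (towards-same v ε _)) (≤-trans (nonneg A v j) (p≤p+q _ 0≤ε))
    ... | inj₂ refl = subst (0ℚ ≤_) (sym (towards-not v ε _)) (p≤q⇒0≤q-p ε≤)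
    here-≤1 : ∀ a → towards v a ε (x j a) ≤ 1ℚ
    here-≤1 a with bool-cases a v
    ... | inj₁ refl = subst (_≤ 1ℚ) (sym (towards-same v ε _))
                        (subst (x j v + ε ≤_) (column′ A j v) (+-monoʳ-≤ (x j v) ε≤))
    ... | inj₂ refl = subst (_≤ 1ℚ) (sym (towards-not v ε _)) (≤-trans (p-q≤p _ 0≤ε) (atMost1 A (not v) j))
    here-sum : ∀ v → towards v false ε (x j false) + towards v true ε (x j true) ≡ 1ℚ
    here-sum false = trans (solve 3 (λ a b e → (a :+ e) :+ (b :- e) := a :+ b) refl (x j false) (x j true) ε) (column A j)
    here-sum true  = trans (solve 3 (λ a b e → (a :- e) :+ (b :+ e) := a :+ b) refl (x j false) (x j true) ε) (column A j)

  module _ {n} (x : LPVars n) (j : Fin n) (v : Bool) (ε : ℚ) (s : Str n) where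

    fdist-shift : fdist s (shift x j v ε) ≡ fdist s x - (towards v (s j) ε (x j (s j)) - x j (s j))
    fdist-shift = begin
      ℕtoℚ n - sumℚ (λ j′ → shift x j v ε j′ (s j′))
        ≡⟨ cong (λ z → ℕtoℚ n - z) (sumℚ-point j _ _ (λ j′ → shift-elsewhere x v ε (s j′))) ⟩
      ℕtoℚ n - (sumℚ (λ j′ → x j′ (s j′)) + (shift x j v ε j (s j) - x j (s j)))
        ≡⟨ cong (λ z → ℕtoℚ n - (sumℚ (λ j′ → x j′ (s j′)) + (z - x j (s j)))) (shift-here x j v ε (s j)) ⟩
      ℕtoℚ n - (sumℚ (λ j′ → x j′ (s j′)) + (towards v (s j) ε (x j (s j)) - x j (s j)))
        ≡⟨ solve 3 (λ N S D → N :- (S :+ D) := (N :- S) :- D) refl (ℕtoℚ n) _ _ ⟩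
      fdist s x - (towards v (s j) ε (x j (s j)) - x j (s j)) ∎
      where open ≡-Reasoning

    fdist-shift-agree : s j ≡ v → fdist s (shift x j v ε) ≡ fdist s x - ε
    fdist-shift-agree refl = trans fdist-shift
      (trans (cong (λ z → fdist s x - (z - x j (s j))) (towards-same (s j) ε _))
             (solve 3 (λ C q e → C :- ((q :+ e) :- q) := C :- e) refl (fdist s x) (x j (s j)) ε))

    fdist-shift-disagree : s j ≡ not v → fdist s (shift x j v ε) ≡ fdist s x + ε
    fdist-shift-disagree sj≡¬v = trans fdist-shift
      (trans (cong (λ a → fdist s x - (towards v a ε (x j a) - x j a)) sj≡¬v)
      (trans (cong (λ z → fdist s x - (z - x j (not v))) (towards-not v ε _))
             (solve 3 (λ C q e → C :- ((q :- e) :- q) := C :+ e) refl (fdist s x) (x j (not v)) ε)))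

    fdist-shift-≤ : 0ℚ ≤ ε → fdist s (shift x j v ε) ≤ fdist s x + ε
    fdist-shift-≤ 0≤ε with bool-cases (s j) v
    ... | inj₁ sj≡v  = subst (_≤ fdist s x + ε) (sym (fdist-shift-agree sj≡v))
                         (+-monoʳ-≤ (fdist s x) (≤-trans (neg-antimono-≤ 0≤ε) 0≤ε))
    ... | inj₂ sj≡¬v = ≤-reflexive (fdist-shift-disagree sj≡¬v)

  admissible-round : ∀ {n F x} {k : Fin n} {b} → Admissible F x → F k ≡ nothing →
    Admissible (update F k b) (shift x k b (x k (not b)))
  admissible-round {F = F} {x} {k} {b} A Fk = record
    { nonneg = nonneg A′ ; atMost1 = atMost1 A′ ; column = column A′ ; fixed = fixed′ }
    where
    δ = x k (not b)
    A′ : Admissible F (shift x k b δ)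
    A′ = admissible-shift A Fk (nonneg A (not b) k) ≤-refl
    fixed′ : ∀ j b′ → update F k b j ≡ just b′ →
      (shift x k b δ j b′ ≡ 1ℚ) × (shift x k b δ j (not b′) ≡ 0ℚ)
    fixed′ j b′ eq with j ≟ k
    fixed′ j b′ refl | yes refl = trans (towards-same b δ (x k b)) (column′ A k b) ,
                                  trans (towards-not b δ δ) (+-inverseʳ δ)
    ... | no _ = fixed A j b′ eq

  common-margin : ∀ {A : Set} {P : A → Set} (f : A → ℚ) {d δ} → 0ℚ < δ → ∀ {as} →
    All (λ a → P a ⊎ f a < d) as → ∃[ ε ] (0ℚ < ε × ε ≤ δ × All (λ a → P a ⊎ f a + ε < d) as)
  common-margin f {δ = δ} 0<δ [] = δ , 0<δ , ≤-refl , []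
  common-margin f 0<δ (inj₁ p ∷ hs) with common-margin f 0<δ hs
  ... | ε , 0<ε , ε≤δ , hs′ = ε , 0<ε , ε≤δ , inj₁ p ∷ hs′
  common-margin {P = P} f {d} 0<δ {a ∷ _} (inj₂ fa<d ∷ hs) with common-margin f 0<δ hs
  ... | ε , 0<ε , ε≤δ , hs′ = ε′ , 0<ε′ , p≤q⇒p⊓r≤q g ε≤δ , inj₂ here ∷ All.map shrink hs′
    where
    g  = (d - f a) * ½
    ε′ = ε ⊓ g
    0<ε′ : 0ℚ < ε′
    0<ε′ with ⊓-sel ε g
    ... | inj₁ ε′≡ε = subst (0ℚ <_) (sym ε′≡ε) 0<ε
    ... | inj₂ ε′≡g = subst (0ℚ <_) (sym ε′≡g) (half-pos (p<q⇒0<q-p fa<d))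
    here : f a + ε′ < d
    here = ≤-<-trans (+-monoʳ-≤ (f a) (p⊓q≤q ε g)) (halfway< fa<d)
    shrink : ∀ {b} → P b ⊎ f b + ε < d → P b ⊎ f b + ε′ < d
    shrink (inj₁ p)  = inj₁ p
    shrink (inj₂ lt) = inj₂ (≤-<-trans (+-monoʳ-≤ (f _) (p⊓q≤p ε g)) lt)

  module _ {n} {s : Str n} {ss : List (Str n)} {F : Fixing n} {x : LPVars n} {d : ℚ}
           (O : Optimal (s ∷ ss) F x d) where

    no-strict-improvement : ∀ {y} → Admissible F y → All (λ s → fdist s y < d) (s ∷ ss) → ⊥
    no-strict-improvement {y} A closer
      with common-margin {P = λ _ → ⊥} (λ s → fdist s y) 0<1 (All.map inj₂ closer)
    ... | ε , 0<ε , _ , margins = <-irrefl refl (≤-<-trans d≤d-ε (p-q<p d 0<ε))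
      where
      below : ∀ {s} → ⊥ ⊎ fdist s y + ε < d → fdist s y ≤ d - ε
      below (inj₁ ())
      below {t} (inj₂ lt) = subst (_≤ d - ε) (solve 2 (λ a e → (a :+ e) :- e := a) refl (fdist t y) ε)
                                  (+-monoˡ-≤ (- ε) (<⇒≤ lt))
      d≤d-ε : d ≤ d - ε
      d≤d-ε = proj₂ O y (d - ε) (feasible A (≤-trans (fdist-nonneg A s) (below (All.head margins)))
                                            (All.map below margins))

    no-improving-shift : ∀ {j v} → F j ≡ nothing → 0ℚ < x j (not v) →
      All (λ s → s j ≡ v ⊎ fdist s x < d) (s ∷ ss) → ⊥
    no-improving-shift {j} {v} Fj 0<x alternatives
      with common-margin (λ s → fdist s x) 0<x alternatives
    ... | ε , 0<ε , ε≤x , margins =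
      no-strict-improvement (admissible-shift (admissible (proj₁ O)) Fj (<⇒≤ 0<ε) ε≤x)
        (All.zipWith closer (margins , within (proj₁ O)))
      where
      closer : ∀ {s} → (s j ≡ v ⊎ fdist s x + ε < d) × fdist s x ≤ d → fdist s (shift x j v ε) < d
      closer {s} (inj₁ sj≡v , ≤d) =
        subst (_< d) (sym (fdist-shift-agree x j v ε s sj≡v)) (<-≤-trans (p-q<p (fdist s x) 0<ε) ≤d)
      closer {s} (inj₂ lt , _) = ≤-<-trans (fdist-shift-≤ x j v ε s (<⇒≤ 0<ε)) lt

  module _ {n} {S : List (Str n)} {F : Fixing n} {x : LPVars n} {d : ℚ} {k : Fin n} {b : Bool} where

    -- While some column j is unfixed, the chosen column is unfixed as well:
    -- a chosen column fixed to not b would have x_{b,k} = 0, and then the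
    -- maximality would force the whole column j to 0.
    chosen-unfixed : Feasible S F x d → F k ≢ just b → (∀ a j → F j ≢ just a → x j a ≤ x k b) →
      (∃ λ j → F j ≡ nothing) → F k ≡ nothing
    chosen-unfixed fe notV₁ maximal (j , Fj) with F k in Fk
    ... | nothing = refl
    ... | just c with bool-cases c b
    ...   | inj₁ refl = ⊥-elim (notV₁ refl)
    ...   | inj₂ refl = ⊥-elim (<-irrefl refl (<-≤-trans 0<1 1≤0))
      where
      A = admissible fe
      xkb≡0 : x k b ≡ 0ℚ
      xkb≡0 = subst (λ a → x k a ≡ 0ℚ) (not-involutive b) (proj₂ (fixed A k (not b) Fk))
      1≤0 : 1ℚ ≤ 0ℚ
      1≤0 = begin
        1ℚ                    ≡⟨ sym (column A j) ⟩
        x j false + x j true  ≤⟨ +-mono-≤ (maximal false j (unfixed≢just Fj)) (maximal true j (unfixed≢just Fj)) ⟩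
        x k b + x k b         ≡⟨ cong₂ _+_ xkb≡0 xkb≡0 ⟩
        0ℚ                    ∎
        where open ≤-Reasoning

    module Rounding (fe : Feasible S F x d) (Fk : F k ≡ nothing)
                    (maximal : ∀ a j → F j ≢ just a → x j a ≤ x k b) where

      δ : ℚ
      δ = x k (not b)

      private
        A = admissible fe

      δ-nonneg : 0ℚ ≤ δ
      δ-nonneg = nonneg A (not b) k

      -- x_{b,k} ≥ x_{¬b,k} and they sum to 1.
      δ≤½ : δ ≤ ½
      δ≤½ = halve-≤ (≤-trans (+-monoˡ-≤ δ (maximal (not b) k (unfixed≢just Fk))) (≤-reflexive (column′ A k b)))

      -- Every letter of every unfixed column carries at least 1 - x_{b,k} = δ.
      δ≤unfixed : ∀ j v → F j ≡ nothing → δ ≤ x j (not v)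
      δ≤unfixed j v Fj = complement-≤ (column′ A k b) (column′ A j v) (maximal v j (unfixed≢just Fj))

      -- Rounding costs at most δ in every distance.
      rounded-feasible : Feasible S (update F k b) (shift x k b δ) (d + δ)
      rounded-feasible = feasible (admissible-round A Fk) (≤-trans (objective-nonneg fe) (p≤p+q d δ-nonneg))
        (All.map (λ {s} fs≤d → ≤-trans (fdist-shift-≤ x k b δ s δ-nonneg) (+-monoˡ-≤ δ fs≤d)) (within fe))

  unfixed-before : ∀ {n} {F : Fixing n} {k j c} → update F k c j ≡ nothing → F j ≡ nothing
  unfixed-before {F = F} {k} {j} eq with j ≟ k
  ... | no _ = eq

  admissible-coarsen : ∀ {n F y} {k : Fin n} {c} → F k ≡ nothing →
    Admissible (update F k c) y → Admissible F y
  admissible-coarsen {F = F} {y} {k} {c} Fk A = record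
    { nonneg = nonneg A ; atMost1 = atMost1 A ; column = column A
    ; fixed = λ j b Fj → fixed A j b (still-fixed j Fj) }
    where
    still-fixed : ∀ j {b} → F j ≡ just b → update F k c j ≡ just b
    still-fixed j Fj with j ≟ k
    ... | yes refl = ⊥-elim (unfixed≢just Fk Fj)
    ... | no _     = Fj

  -- Then fdist a x + fdist b x is the same for all admissible x: every unfixed
  -- column contributes x_{a,j} + x_{¬a,j} = 1 and every fixed one a constant.

  Opposed : ∀ {n} → Str n → Str n → Fixing n → Set
  Opposed a b F = ∀ j → F j ≡ nothing → a j ≢ b j

  opposed-refine : ∀ {n} {a b : Str n} {F k c} → Opposed a b F → Opposed a b (update F k c)
  opposed-refine {F = F} {k} {c} opp j Fj = opp j (unfixed-before {F = F} {k} {j} {c} Fj)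

  opposed? : ∀ {n} (a b : Str n) F → Opposed a b F ⊎ ∃ λ j → F j ≡ nothing × a j ≡ b j
  opposed? a b F with any? (λ j → ≡-dec Bool._≟_ (F j) nothing ×-dec (a j Bool.≟ b j))
  ... | yes witness = inj₂ witness
  ... | no  none    = inj₁ (λ j Fj a≡b → none (j , Fj , a≡b))

  pairSum : ∀ {n} → Str n → Str n → LPVars n → ℚ
  pairSum a b x = fdist a x + fdist b x

  pairSum-invariant : ∀ {n F x y} {a b : Str n} → Opposed a b F →
    Admissible F x → Admissible F y → pairSum a b x ≡ pairSum a b y
  pairSum-invariant {n} {F} {x} {y} {a} {b} opp Ax Ay =
    trans (as-sum x) (trans (cong (λ z → (ℕtoℚ n + ℕtoℚ n) - z) (sumℚ-cong columns)) (sym (as-sum y)))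
    where
    as-sum : ∀ z → pairSum a b z ≡ (ℕtoℚ n + ℕtoℚ n) - sumℚ (λ j → z j (a j) + z j (b j))
    as-sum z = trans (solve 3 (λ N p q → (N :- p) :+ (N :- q) := (N :+ N) :- (p :+ q)) refl (ℕtoℚ n) _ _)
      (cong (λ w → (ℕtoℚ n + ℕtoℚ n) - w) (sym (sumℚ-+ (λ j → z j (a j)) (λ j → z j (b j)))))
    columns : ∀ j → x j (a j) + x j (b j) ≡ y j (a j) + y j (b j)
    columns j with F j in Fj
    ... | nothing = trans (cong (λ c → x j (a j) + x j c) b≡¬a)
                      (trans (column′ Ax j (a j)) (sym (trans (cong (λ c → y j (a j) + y j c) b≡¬a) (column′ Ay j (a j)))))
      where b≡¬a = ¬-not (λ b≡a → opp j Fj (sym b≡a))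
    ... | just c = cong₂ _+_ (fixed-agree Ax Ay Fj (a j)) (fixed-agree Ax Ay Fj (b j))

  indicator : ∀ {n} → Str n → LPVars n
  indicator w j a = if does (w j Bool.≟ a) then 1ℚ else 0ℚ

  admissible-indicator : ∀ {n F} (w : Str n) → (∀ j b → F j ≡ just b → b ≡ w j) → Admissible F (indicator w)
  admissible-indicator w consistent = record
    { nonneg  = λ a j → nonneg′ (w j) a
    ; atMost1 = λ a j → atMost1′ (w j) a
    ; column  = λ j → column″ (w j)
    ; fixed   = λ { j b Fj → subst (λ c → indicator w j c ≡ 1ℚ × indicator w j (not c) ≡ 0ℚ)
                                   (sym (consistent j b Fj)) (values (w j)) }
    }
    where
    nonneg′ : ∀ c a → 0ℚ ≤ (if does (c Bool.≟ a) then 1ℚ else 0ℚ)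
    nonneg′ false false = 0≤1
    nonneg′ false true  = ≤-refl
    nonneg′ true  false = ≤-refl
    nonneg′ true  true  = 0≤1
    atMost1′ : ∀ c a → (if does (c Bool.≟ a) then 1ℚ else 0ℚ) ≤ 1ℚ
    atMost1′ false false = ≤-refl
    atMost1′ false true  = 0≤1
    atMost1′ true  false = 0≤1
    atMost1′ true  true  = ≤-refl
    column″ : ∀ c → (if does (c Bool.≟ false) then 1ℚ else 0ℚ) + (if does (c Bool.≟ true) then 1ℚ else 0ℚ) ≡ 1ℚ
    column″ false = refl
    column″ true  = refl
    values : ∀ c → (if does (c Bool.≟ c) then 1ℚ else 0ℚ) ≡ 1ℚ × (if does (c Bool.≟ not c) then 1ℚ else 0ℚ) ≡ 0ℚ
    values false = refl , refl
    values true  = refl , refl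

  fdist-indicator : ∀ {n} (w s : Str n) → fdist s (indicator w) ≡ ℕtoℚ (ham w s)
  fdist-indicator {n} w s =
    trans (cong (_- agreements) (sym (agreements+ham w s)))
          (solve 2 (λ A H → (A :+ H) :- A := H) refl agreements (ℕtoℚ (ham w s)))
    where
    agreements = sumℚ (λ j → indicator w j (s j))
    column-split : ∀ {P : Set} (agree : Dec P) A H →
      (if does agree then 1ℚ else 0ℚ) + A + ℕtoℚ ((if does agree then 0 else 1) ℕ.+ H) ≡ 1ℚ + (A + ℕtoℚ H)
    column-split (yes _) A H = +-assoc 1ℚ A (ℕtoℚ H)
    column-split (no _)  A H = trans (cong (0ℚ + A +_) (ℕtoℚ-suc H))
      (solve 2 (λ A h → con 0ℚ :+ A :+ (con 1ℚ :+ h) := con 1ℚ :+ (A :+ h)) refl A (ℕtoℚ H))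
    agreements+ham : ∀ {m} (w s : Str m) → sumℚ (λ j → indicator w j (s j)) + ℕtoℚ (ham w s) ≡ ℕtoℚ m
    agreements+ham {zero}  w s = refl
    agreements+ham {suc m} w s = trans (column-split (w zero Bool.≟ s zero) _ _)
      (trans (cong (1ℚ +_) (agreements+ham (λ j → w (suc j)) (λ j → s (suc j)))) (sym (ℕtoℚ-suc m)))

  maxDist-bounds : ∀ {n} (S : List (Str n)) t → All (λ s → ham t s ℕ.≤ maxDist S t) S
  maxDist-bounds []       t = []
  maxDist-bounds (s ∷ ss) t =
    ℕ.m≤m⊔n (ham t s) _ ∷ All.map (λ h → ℕ.≤-trans h (ℕ.m≤n⊔m (ham t s) _)) (maxDist-bounds ss t)

  maxDist-least : ∀ {n} {S : List (Str n)} {t m} → All (λ s → ham t s ℕ.≤ m) S → maxDist S t ℕ.≤ m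
  maxDist-least []       = ℕ.z≤n
  maxDist-least (h ∷ hs) = ℕ.⊔-lub h (maxDist-least hs)

  Achievable : ∀ {n} → List (Str n) → Fixing n → ℚ → Set
  Achievable S F B = ∃ λ y → ∃ λ e → Feasible S F y e × e ≤ B

  optimum-≤ : ∀ {n S F x d B} → Optimal {n} S F x d → Achievable S F B → d ≤ B
  optimum-≤ (_ , best) (y , e , fe , e≤B) = ≤-trans (best y e fe) e≤B

  achievable-initial : ∀ {n} (S : List (Str n)) u → Achievable S (λ _ → nothing) (ℕtoℚ (maxDist S u))
  achievable-initial S u =
    indicator u , ℕtoℚ (maxDist S u) ,
    feasible (admissible-indicator u (λ _ _ ())) (ℕtoℚ-nonneg (maxDist S u))
             (All.map (λ {s} h → subst (_≤ ℕtoℚ (maxDist S u)) (sym (fdist-indicator u s)) (ℕtoℚ-mono h))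
                      (maxDist-bounds S u)) ,
    ≤-refl

  -- Once every column is fixed to t, every admissible point is the indicator
  -- of t, so a feasible value B bounds all distances from t.
  output-bound : ∀ {n S F t B} → (∀ k → F k ≡ just (t k)) → Achievable {n} S F B →
    All (λ s → ℕtoℚ (ham t s) ≤ B) S
  output-bound {n} {F = F} {t} {B} F≡t (y , e , fe , e≤B) = All.map (λ {s} → bound s) (within fe)
    where
    It = admissible-indicator t (λ j b Fj → just-injective (trans (sym Fj) (F≡t j)))
    bound : ∀ s → fdist s y ≤ e → ℕtoℚ (ham t s) ≤ B
    bound s ≤e = begin
      ℕtoℚ (ham t s)         ≡⟨ sym (fdist-indicator t s) ⟩
      fdist s (indicator t)  ≡⟨ cong (λ z → ℕtoℚ n - z) (sumℚ-cong (λ j → fixed-agree It (admissible fe) (F≡t j) (s j))) ⟩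
      fdist s y              ≤⟨ ≤e ⟩
      e                      ≤⟨ e≤B ⟩
      B                      ∎
      where open ≤-Reasoning

  integral-bound : ∀ {a m} → ℕtoℚ a ≤ ℕtoℚ m + 1ℚ → a ℕ.≤ m ℕ.+ 1
  integral-bound {m = m} h = ℕtoℚ-cancel-≤ (subst (_ ≤_) (sym (ℕtoℚ-+ m 1)) h)

  -- Counting unfixed columns.  Each iteration fixes at most one new column, so
  -- after i < n iterations some column is still unfixed.

  unfixedCount : ∀ {n} → Fixing n → ℕ
  unfixedCount {zero}  F = 0
  unfixedCount {suc n} F = isNothing (F zero) ℕ.+ unfixedCount (λ j → F (suc j))
    where
    isNothing : Maybe Bool → ℕ
    isNothing nothing  = 1
    isNothing (just _) = 0

  unfixedCount-initial : ∀ n → unfixedCount {n} (λ _ → nothing) ≡ n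
  unfixedCount-initial zero    = refl
  unfixedCount-initial (suc n) = cong suc (unfixedCount-initial n)

  unfixedCount-update : ∀ {n} (F : Fixing n) k b → unfixedCount F ℕ.≤ suc (unfixedCount (update F k b))
  unfixedCount-update F zero b with F zero
  ... | nothing = ℕ.≤-refl
  ... | just _  = ℕ.n≤1+n _
  unfixedCount-update F (suc k) b with F zero
  ... | nothing = ℕ.s≤s (unfixedCount-update (λ j → F (suc j)) k b)
  ... | just _  = unfixedCount-update (λ j → F (suc j)) k b

  unfixedCount-witness : ∀ {n} (F : Fixing n) → 0 ℕ.< unfixedCount F → ∃ λ j → F j ≡ nothing
  unfixedCount-witness {suc n} F pos with F zero in F0
  ... | nothing = zero , F0
  ... | just _ with unfixedCount-witness (λ j → F (suc j)) pos
  ...   | j , Fj = suc j , Fj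

  reach-unfixed : ∀ {n} {S : List (Str n)} {i F} → Reach S i F → n ℕ.≤ unfixedCount F ℕ.+ i
  reach-unfixed {n} start = ℕ.≤-reflexive (sym (trans (ℕ.+-identityʳ _) (unfixedCount-initial n)))
  reach-unfixed (step {i} {F} r x d O b k _ _) = begin
    _                                ≤⟨ reach-unfixed r ⟩
    unfixedCount F ℕ.+ i             ≤⟨ ℕ.+-monoˡ-≤ i (unfixedCount-update F k b) ⟩
    suc (unfixedCount (update F k b)) ℕ.+ i ≡⟨ sym (ℕ.+-suc _ i) ⟩
    unfixedCount (update F k b) ℕ.+ suc i ∎
    where open ℕ.≤-Reasoning

  reach-has-unfixed : ∀ {n} {S : List (Str n)} {i F} → Reach S i F → i ℕ.< n → ∃ λ j → F j ≡ nothing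
  reach-has-unfixed {F = F} r i<n with unfixedCount F in count | reach-unfixed r
  ... | zero  | n≤i = ⊥-elim (ℕ.<-irrefl refl (ℕ.<-≤-trans i<n n≤i))
  ... | suc _ | _   = unfixedCount-witness F (subst (0 ℕ.<_) (sym count) (ℕ.s≤s ℕ.z≤n))

  module ThreeStrings {n} (s₁ s₂ s₃ : Str n) where

    S : List (Str n)
    S = s₁ ∷ s₂ ∷ s₃ ∷ []

    data Pair : Set where
      p₁₂ p₁₃ p₂₃ : Pair

    first second third : Pair → Str n
    first p₁₂ = s₁
    first p₁₃ = s₁
    first p₂₃ = s₂
    second p₁₂ = s₂
    second p₁₃ = s₃
    second p₂₃ = s₃
    third p₁₂ = s₃
    third p₁₃ = s₂
    third p₂₃ = s₁

    Split : Pair → Fixing n → Set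
    Split π = Opposed (first π) (second π)

    -- Three bits cannot be pairwise different, so while a column is unfixed
    -- some pair is not split.
    not-all-split : ∀ {F k} → F k ≡ nothing → (∀ π → Split π F) → ⊥
    not-all-split {k = k} Fk split =
      split p₂₃ k Fk (trans (¬-not (≢-sym (split p₁₂ k Fk))) (sym (¬-not (≢-sym (split p₁₃ k Fk)))))

    TightPair : Fixing n → LPVars n → ℚ → Set
    TightPair F x d = Σ Pair λ π → Split π F × d ≤ fdist (first π) x × d ≤ fdist (second π) x

    module Tightness {F x d} (O : Optimal S F x d) {δ} (0<δ : 0ℚ < δ)
                     (δ≤ : ∀ j v → F j ≡ nothing → δ ≤ x j (not v)) where

      Tight : Str n → Set
      Tight s = d ≤ fdist s x

      not-unanimous : ∀ {j} v → F j ≡ nothing →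
        (s₁ j ≡ v ⊎ fdist s₁ x < d) → (s₂ j ≡ v ⊎ fdist s₂ x < d) → (s₃ j ≡ v ⊎ fdist s₃ x < d) → ⊥
      not-unanimous {j} v Fj h₁ h₂ h₃ = no-improving-shift O Fj (<-≤-trans 0<δ (δ≤ j v Fj)) (h₁ ∷ h₂ ∷ h₃ ∷ [])

      pair-agreement : ∀ π {j} → F j ≡ nothing → second π j ≡ first π j →
        (third π j ≡ first π j ⊎ fdist (third π) x < d) → ⊥
      pair-agreement p₁₂ Fj agree h = not-unanimous _ Fj (inj₁ refl) (inj₁ agree) h
      pair-agreement p₁₃ Fj agree h = not-unanimous _ Fj (inj₁ refl) h (inj₁ agree)
      pair-agreement p₂₃ Fj agree h = not-unanimous _ Fj h (inj₁ refl) (inj₁ agree)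

      Majority : Pair → Fin n → Set
      Majority π j = F j ≡ nothing × second π j ≡ first π j × third π j ≡ not (first π j)

      majority : ∀ π → (∃ λ j → F j ≡ nothing × first π j ≡ second π j) → ∃ (Majority π)
      majority π (j , Fj , agree) = classify (bool-cases (third π j) (first π j))
        where
        classify : third π j ≡ first π j ⊎ third π j ≡ not (first π j) → ∃ (Majority π)
        classify (inj₁ same)  = ⊥-elim (pair-agreement π Fj (sym agree) (inj₁ same))
        classify (inj₂ other) = j , Fj , sym agree , other

      -- Majority columns for all three pairs are impossible: shifting δ towards
      -- the majority letter in each of them brings every string δ closer,
      -- since each string is in the majority twice and in the minority once.
      no-cyclic-majorities : ∃ (Majority p₁₂) → ∃ (Majority p₁₃) → ∃ (Majority p₂₃) → ⊥
      no-cyclic-majorities (j₁₂ , F₁₂ , a₁₂ , b₁₂) (j₁₃ , F₁₃ , a₁₃ , b₁₃) (j₂₃ , F₂₃ , a₂₃ , b₂₃) =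
        no-strict-improvement O A₃ (All.zipWith closer ((e₁ ∷ e₂ ∷ e₃ ∷ []) , within (proj₁ O)))
        where
        A = admissible (proj₁ O)
        y₁ = shift x  j₁₂ (s₁ j₁₂) δ
        y₂ = shift y₁ j₁₃ (s₁ j₁₃) δ
        y₃ = shift y₂ j₂₃ (s₂ j₂₃) δ
        j₁₃≢j₁₂ : j₁₃ ≢ j₁₂
        j₁₃≢j₁₂ refl = not-¬ refl (trans (sym a₁₃) b₁₂)
        j₂₃≢j₁₂ : j₂₃ ≢ j₁₂
        j₂₃≢j₁₂ refl = not-¬ refl (trans a₁₂ b₂₃)
        j₂₃≢j₁₃ : j₂₃ ≢ j₁₃
        j₂₃≢j₁₃ refl = not-¬ refl (trans (sym (trans (sym a₂₃) a₁₃)) b₁₃)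
        A₁ : Admissible F y₁
        A₁ = admissible-shift A F₁₂ (<⇒≤ 0<δ) (δ≤ j₁₂ (s₁ j₁₂) F₁₂)
        A₂ : Admissible F y₂
        A₂ = admissible-shift A₁ F₁₃ (<⇒≤ 0<δ)
               (subst (δ ≤_) (sym (shift-elsewhere x (s₁ j₁₂) δ _ j₁₃≢j₁₂)) (δ≤ j₁₃ (s₁ j₁₃) F₁₃))
        A₃ : Admissible F y₃
        A₃ = admissible-shift A₂ F₂₃ (<⇒≤ 0<δ)
               (subst (δ ≤_) (sym (trans (shift-elsewhere y₁ (s₁ j₁₃) δ _ j₂₃≢j₁₃)
                                         (shift-elsewhere x (s₁ j₁₂) δ _ j₂₃≢j₁₂)))
                      (δ≤ j₂₃ (s₂ j₂₃) F₂₃))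
        closer : ∀ {s} → fdist s y₃ ≡ fdist s x - δ × fdist s x ≤ d → fdist s y₃ < d
        closer {s} (eq , ≤d) = subst (_< d) (sym eq) (<-≤-trans (p-q<p (fdist s x) 0<δ) ≤d)
        e₁ : fdist s₁ y₃ ≡ fdist s₁ x - δ
        e₁ = trans (fdist-shift-disagree y₂ j₂₃ _ δ s₁ b₂₃)
              (trans (cong (_+ δ) (trans (fdist-shift-agree y₁ j₁₃ _ δ s₁ refl)
                                          (cong (_- δ) (fdist-shift-agree x j₁₂ _ δ s₁ refl))))
                     (solve 2 (λ C e → ((C :- e) :- e) :+ e := C :- e) refl (fdist s₁ x) δ))
        e₂ : fdist s₂ y₃ ≡ fdist s₂ x - δ
        e₂ = trans (fdist-shift-agree y₂ j₂₃ _ δ s₂ refl)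
              (trans (cong (_- δ) (trans (fdist-shift-disagree y₁ j₁₃ _ δ s₂ b₁₃)
                                          (cong (_+ δ) (fdist-shift-agree x j₁₂ _ δ s₂ a₁₂))))
                     (solve 2 (λ C e → ((C :- e) :+ e) :- e := C :- e) refl (fdist s₂ x) δ))
        e₃ : fdist s₃ y₃ ≡ fdist s₃ x - δ
        e₃ = trans (fdist-shift-agree y₂ j₂₃ _ δ s₃ a₂₃)
              (trans (cong (_- δ) (trans (fdist-shift-agree y₁ j₁₃ _ δ s₃ a₁₃)
                                          (cong (_- δ) (fdist-shift-disagree x j₁₂ _ δ s₃ b₁₂))))
                     (solve 2 (λ C e → ((C :+ e) :- e) :- e := C :- e) refl (fdist s₃ x) δ))

      third-slack : ∀ π → Tight (first π) → Tight (second π) → fdist (third π) x < d → TightPair F x d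
      third-slack π t t′ slack₃ = classify (opposed? (first π) (second π) F)
        where
        classify : Split π F ⊎ ∃ (λ j → F j ≡ nothing × first π j ≡ second π j) → TightPair F x d
        classify (inj₁ split)              = π , split , t , t′
        classify (inj₂ (j , Fj , agree)) = ⊥-elim (pair-agreement π Fj (sym agree) (inj₂ slack₃))

      -- With all three strings tight, some pair is split: otherwise every pair
      -- has a majority column.
      all-tight : Tight s₁ → Tight s₂ → Tight s₃ → TightPair F x d
      all-tight t₁ t₂ t₃ = classify (opposed? s₁ s₂ F) (opposed? s₁ s₃ F) (opposed? s₂ s₃ F)
        where
        Witness : Pair → Set
        Witness π = Split π F ⊎ ∃ (λ j → F j ≡ nothing × first π j ≡ second π j)
        classify : Witness p₁₂ → Witness p₁₃ → Witness p₂₃ → TightPair F x d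
        classify (inj₁ split) _ _ = p₁₂ , split , t₁ , t₂
        classify _ (inj₁ split) _ = p₁₃ , split , t₁ , t₃
        classify _ _ (inj₁ split) = p₂₃ , split , t₂ , t₃
        classify (inj₂ w₁₂) (inj₂ w₁₃) (inj₂ w₂₃) =
          ⊥-elim (no-cyclic-majorities (majority p₁₂ w₁₂) (majority p₁₃ w₁₃) (majority p₂₃ w₂₃))

      -- At least two strings are tight (else shift at column k towards the
      -- tight one, if any), and the two cases above apply.
      tight-pair : ∀ {k} → F k ≡ nothing → TightPair F x d
      tight-pair {k} Fk = classify (d ≤? fdist s₁ x) (d ≤? fdist s₂ x) (d ≤? fdist s₃ x)
        where
        slack : ∀ {A : Set} {s} → ¬ Tight s → A ⊎ fdist s x < d
        slack ¬t = inj₂ (≰⇒> ¬t)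
        classify : Dec (Tight s₁) → Dec (Tight s₂) → Dec (Tight s₃) → TightPair F x d
        classify (no ¬t₁) (no ¬t₂) _ = ⊥-elim (not-unanimous (s₃ k) Fk (slack ¬t₁) (slack ¬t₂) (inj₁ refl))
        classify (no ¬t₁) _ (no ¬t₃) = ⊥-elim (not-unanimous (s₂ k) Fk (slack ¬t₁) (inj₁ refl) (slack ¬t₃))
        classify _ (no ¬t₂) (no ¬t₃) = ⊥-elim (not-unanimous (s₁ k) Fk (inj₁ refl) (slack ¬t₂) (slack ¬t₃))
        classify (yes t₁) (yes t₂) (no ¬t₃) = third-slack p₁₂ t₁ t₂ (≰⇒> ¬t₃)
        classify (yes t₁) (no ¬t₂) (yes t₃) = third-slack p₁₃ t₁ t₃ (≰⇒> ¬t₂)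
        classify (no ¬t₁) (yes t₂) (yes t₃) = third-slack p₂₃ t₂ t₃ (≰⇒> ¬t₁)
        classify (yes t₁) (yes t₂) (yes t₃) = all-tight t₁ t₂ t₃

    within-pair : ∀ {F x d} → Feasible S F x d → ∀ π → fdist (first π) x ≤ d × fdist (second π) x ≤ d
    within-pair {x = x} {d} fe π = select π (within fe)
      where
      select : ∀ π → All (λ s → fdist s x ≤ d) S → fdist (first π) x ≤ d × fdist (second π) x ≤ d
      select p₁₂ (w₁ ∷ w₂ ∷ w₃ ∷ []) = w₁ , w₂
      select p₁₃ (w₁ ∷ w₂ ∷ w₃ ∷ []) = w₁ , w₃
      select p₂₃ (w₁ ∷ w₂ ∷ w₃ ∷ []) = w₂ , w₃

    _≟ₚ_ : (π π′ : Pair) → Dec (π ≡ π′)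
    p₁₂ ≟ₚ p₁₂ = yes refl
    p₁₃ ≟ₚ p₁₃ = yes refl
    p₂₃ ≟ₚ p₂₃ = yes refl
    p₁₂ ≟ₚ p₁₃ = no λ ()
    p₁₂ ≟ₚ p₂₃ = no λ ()
    p₁₃ ≟ₚ p₁₂ = no λ ()
    p₁₃ ≟ₚ p₂₃ = no λ ()
    p₂₃ ≟ₚ p₁₂ = no λ ()
    p₂₃ ≟ₚ p₁₃ = no λ ()

    all-but-one : ∀ {P : Pair → Set} π π′ → π ≢ π′ → P π → P π′ → ∃ λ ρ → ∀ σ → σ ≢ ρ → P σ
    all-but-one p₁₂ p₁₂ π≢π′ _ _ = ⊥-elim (π≢π′ refl)
    all-but-one p₁₃ p₁₃ π≢π′ _ _ = ⊥-elim (π≢π′ refl)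
    all-but-one p₂₃ p₂₃ π≢π′ _ _ = ⊥-elim (π≢π′ refl)
    all-but-one p₁₂ p₁₃ _ h h′ = p₂₃ , λ { p₁₂ _ → h  ; p₁₃ _ → h′ ; p₂₃ ne → ⊥-elim (ne refl) }
    all-but-one p₁₃ p₁₂ _ h h′ = p₂₃ , λ { p₁₂ _ → h′ ; p₁₃ _ → h  ; p₂₃ ne → ⊥-elim (ne refl) }
    all-but-one p₁₂ p₂₃ _ h h′ = p₁₃ , λ { p₁₂ _ → h  ; p₂₃ _ → h′ ; p₁₃ ne → ⊥-elim (ne refl) }
    all-but-one p₂₃ p₁₂ _ h h′ = p₁₃ , λ { p₁₂ _ → h′ ; p₂₃ _ → h  ; p₁₃ ne → ⊥-elim (ne refl) }
    all-but-one p₁₃ p₂₃ _ h h′ = p₁₂ , λ { p₁₃ _ → h  ; p₂₃ _ → h′ ; p₁₂ ne → ⊥-elim (ne refl) }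
    all-but-one p₂₃ p₁₃ _ h h′ = p₁₂ , λ { p₁₃ _ → h′ ; p₂₃ _ → h  ; p₁₂ ne → ⊥-elim (ne refl) }

    every : ∀ {P : Pair → Set} ρ → P ρ → (∀ σ → σ ≢ ρ → P σ) → ∀ σ → P σ
    every ρ pρ others σ with σ ≟ₚ ρ
    ... | yes refl = pρ
    ... | no σ≢ρ   = others σ σ≢ρ

    module Analysis (D : ℚ) where

      -- A recorded pair is split and has pair sum at most B + B at every
      -- admissible point (the pair sum being the same at all of them).
      record Recorded (π : Pair) (F : Fixing n) (B : ℚ) : Set where
        field
          split : Split π F
          bound : ∀ y → Admissible F y → pairSum (first π) (second π) y ≤ B + B

      open Recorded

      recorded-weaken : ∀ {π F B B′} → B ≤ B′ → Recorded π F B → Recorded π F B′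
      recorded-weaken B≤B′ r = record { split = split r ; bound = λ y A → ≤-trans (bound r y A) (+-mono-≤ B≤B′ B≤B′) }

      recorded-refine : ∀ {π F k b B} → F k ≡ nothing → Recorded π F B → Recorded π (update F k b) B
      recorded-refine {F = F} {k} {b} Fk r = record
        { split = opposed-refine {F = F} {k} {b} (split r) ; bound = λ y A → bound r y (admissible-coarsen Fk A) }

      split-recorded : ∀ {F x d π} → Optimal S F x d → Split π F → Recorded π F d
      split-recorded {π = π} O sp = record
        { split = sp
        ; bound = λ y A → ≤-trans (≤-reflexive (pairSum-invariant sp A (admissible (proj₁ O))))
                                  (uncurry +-mono-≤ (within-pair (proj₁ O) π)) }

      tight-bounded : ∀ {F x d π B} → Feasible S F x d → Recorded π F B →
        d ≤ fdist (first π) x → d ≤ fdist (second π) x → d ≤ B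
      tight-bounded {x = x} fe r t t′ = halve-≤ (≤-trans (+-mono-≤ t t′) (bound r x (admissible fe)))

      -- Every fixing reached by the algorithm
      -- is in one of three stages; the LP optimum rises by at most ½ with each
      -- newly recorded pair, and a third pair can never be recorded.
      data Stage (F : Fixing n) : Set where
        no-pair   : Achievable S F D → Stage F
        one-pair  : ∀ π → Recorded π F D → Achievable S F (D + ½) → Stage F
        two-pairs : ∀ ρ → (∀ π → π ≢ ρ → Recorded π F (D + ½)) → Achievable S F (D + 1ℚ) → Stage F

      level : ∀ {F} → Stage F → ℚ
      level (no-pair _)       = D
      level (one-pair _ _ _)  = D + ½
      level (two-pairs _ _ _) = D + 1ℚ

      achievable : ∀ {F} (st : Stage F) → Achievable S F (level st)
      achievable (no-pair a)       = a
      achievable (one-pair _ _ a)  = a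
      achievable (two-pairs _ _ a) = a

      level≤D+1 : ∀ {F} (st : Stage F) → level st ≤ D + 1ℚ
      level≤D+1 (no-pair _)       = p≤p+q D 0≤1
      level≤D+1 (one-pair _ _ _)  = +-monoʳ-≤ D ½≤1
      level≤D+1 (two-pairs _ _ _) = ≤-refl

      module Iteration {F x d k b} (O : Optimal S F x d) (Fk : F k ≡ nothing)
                       (maximal : ∀ a j → F j ≢ just a → x j a ≤ x k b) where

        open Rounding (proj₁ O) Fk maximal

        F′ : Fixing n
        F′ = update F k b

        reach : ∀ {B} → d + δ ≤ B → Achievable S F′ B
        reach d+δ≤B = _ , _ , rounded-feasible , d+δ≤B

        refine : ∀ {π B} → Recorded π F B → Recorded π F′ B
        refine = recorded-refine {b = b} Fk

        keep : (st : Stage F) → d + δ ≤ level st → Stage F′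
        keep (no-pair _)        le = no-pair (reach le)
        keep (one-pair π r _)   le = one-pair π (refine r) (reach le)
        keep (two-pairs ρ rs _) le = two-pairs ρ (λ π π≢ρ → refine (rs π π≢ρ)) (reach le)

        -- If δ > 0, the tight split pair π₀ is either recorded now, or it was
        -- recorded already and then bounds d.
        grow : Stage F → TightPair F x d → Stage F′
        grow (no-pair a) (π₀ , split₀ , _ , _) =
          one-pair π₀ (recorded-weaken d≤D (refine (split-recorded O split₀))) (reach (+-mono-≤ d≤D δ≤½))
          where d≤D = optimum-≤ O a
        grow (one-pair π r a) (π₀ , split₀ , t , t′) = compare (π₀ ≟ₚ π)
          where
          compare : Dec (π₀ ≡ π) → Stage F′
          compare (yes refl) = keep (one-pair π r a) (+-mono-≤ (tight-bounded (proj₁ O) r t t′) δ≤½)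
          compare (no π₀≢π)  =
            let ρ , recorded = all-but-one π π₀ (≢-sym π₀≢π)
                                 (recorded-weaken (p≤p+q D (≤ᵇ⇒≤ _)) (refine r))
                                 (recorded-weaken (optimum-≤ O a) (refine (split-recorded O split₀)))
            in two-pairs ρ recorded (reach (half-step D (optimum-≤ O a) δ≤½))
        grow (two-pairs ρ rs a) (π₀ , split₀ , t , t′) = compare (π₀ ≟ₚ ρ)
          where
          compare : Dec (π₀ ≡ ρ) → Stage F′
          compare (yes refl) = ⊥-elim (not-all-split Fk (every π₀ split₀ (λ σ σ≢π₀ → split (rs σ σ≢π₀))))
          compare (no π₀≢ρ)  = keep (two-pairs ρ rs a) (half-step D (tight-bounded (proj₁ O) (rs π₀ π₀≢ρ) t t′) δ≤½)

        advance : Stage F → Stage F′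
        advance st = proceed (δ ≤? 0ℚ)
          where
          proceed : Dec (δ ≤ 0ℚ) → Stage F′
          proceed (yes δ≤0) = keep st (≤-trans (+-monoʳ-≤ d δ≤0)
                                       (≤-trans (≤-reflexive (+-identityʳ d)) (optimum-≤ O (achievable st))))
          proceed (no δ≰0)  = grow st (Tightness.tight-pair O (≰⇒> δ≰0) δ≤unfixed Fk)

      reach-stage : ∀ {i F} → Achievable S (λ _ → nothing) D → Reach S i F → i ℕ.≤ n → Stage F
      reach-stage init start _ = no-pair init
      reach-stage init (step {i} r x d O b k notV₁ maximal) i<n =
        Iteration.advance O (chosen-unfixed (proj₁ O) notV₁ maximal (reach-has-unfixed r i<n)) maximal
                          (reach-stage init r (ℕ.<⇒≤ i<n))

      achievable-D+1 : ∀ {F} → Stage F → Achievable S F (D + 1ℚ)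
      achievable-D+1 st with achievable st
      ... | y , e , fe , e≤level = y , e , fe , ≤-trans e≤level (level≤D+1 st)

open import Data.Nat using (ℕ; _≤_; _+_)
open import Data.Nat.Properties using (≤-refl)
open import Data.List using (_∷_; [])
open import Data.Product using (_,_)
open import Data.List.Relation.Unary.All as All using ()
open AlgorithmA

theorem2 : ∀ {n} (s₁ s₂ s₃ : Str n) (t : Str n) →
    Output (s₁ ∷ s₂ ∷ s₃ ∷ []) t →
    (u : Str n) → maxDist (s₁ ∷ s₂ ∷ s₃ ∷ []) t ≤ maxDist (s₁ ∷ s₂ ∷ s₃ ∷ []) u + 1
theorem2 s₁ s₂ s₃ t (F , run , F≡t) u =
  maxDist-least (All.map integral-bound
    (output-bound F≡t (achievable-D+1 (reach-stage (achievable-initial S u) run ≤-refl))))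
  where
  open ThreeStrings s₁ s₂ s₃ using (S; module Analysis)
  open Analysis (ℕtoℚ (maxDist S u))
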